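{- Let $p$ be an odd prime and $i\in\{1,2\}$. Then $p$ is rogue of the $i^{\text{th}}$ kind if and only if $2$ is not a primitive root modulo $p$.
   Context: For an odd prime $p$ and $i\in\{1,2\}$, let $A_i^p=(\mathbb{Z}/p\mathbb{Z})^\times\setminus\{(-1)^i \bmod p\}$. For $g\in A_i^p$ define $u_1=g$ and $u_n=2u_{n-1}+(-1)^{i+1}$ in $\mathbb{Z}/p\mathbb{Z}$ for $n>1$; let $g_k^i=\min(\{n\in\mathbb{N}: u_n=0\}\cup\{\infty\})$, and call $\langle g\rangle_i^p=(u_n)_{1\le n<g_k^i}$ the rogue sequence of $g$. A rogue sequence which is periodic (equivalently, never reaches $0$, so $g_k^i=\infty$) is called a rogue loop. The prime $p$ is rogue of the $i^{\text{th}}$ kind if there exists $g\in A_i^p$ such that $\langle g\rangle_i^p$ is a rogue loop. -}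

module Defs where

open import Data.Nat using (ℕ; zero; suc; _+_; _*_; _∸_; _^_; _<_; NonZero)
open import Data.Nat.DivMod using (_%_)
open import Data.Product using (Σ; _×_; ∃-syntax)
open import Relation.Binary.PropositionalEquality using (_≡_; _≢_)

-- Residues mod p are represented by natural numbers r < p (canonical reps).

negOnePow : (i p : ℕ) → .{{NonZero p}} → ℕ
negOnePow zero    p = 1 % p
negOnePow (suc i) p = (p ∸ negOnePow i p) % p

-- A_i^p = (Z/pZ)^× \ {(-1)^i mod p}  (for p prime, (Z/pZ)^× = nonzero residues)
InA : (i p : ℕ) → .{{NonZero p}} → ℕ → Set
InA i p g = (g < p) × (g ≢ 0) × (g ≢ negOnePow i p)

-- roguePt i p g n  =  u_{n+1}, where u_1 = g, u_n = 2 u_{n-1} + (-1)^{i+1} in Z/pZ.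
roguePt : (i p : ℕ) → .{{NonZero p}} → ℕ → ℕ → ℕ
roguePt i p g zero    = g
roguePt i p g (suc n) = (2 * roguePt i p g n + negOnePow (suc i) p) % p

RogueLoop : (i p : ℕ) → .{{NonZero p}} → ℕ → Set
RogueLoop i p g = (n : ℕ) → roguePt i p g n ≢ 0

RogueOfKind : (i p : ℕ) → .{{NonZero p}} → Set
RogueOfKind i p = ∃[ g ] (InA i p g × RogueLoop i p g)

PrimitiveRoot : (a p : ℕ) → .{{NonZero p}} → Set
PrimitiveRoot a p = (a % p ≢ 0) × ((k : ℕ) → 0 < k → k < p ∸ 1 → (a ^ k) % p ≢ 1)

{-# OPTIONS --safe #-}
-- Shifting by c = (-1)^(i+1) conjugates the step u ↦ 2u + c into doubling: u_n + c ≡ 2^n (g + c)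
-- (mod p). So every residue other than the fixed point e = (-1)^i lies on a cycle whose length is
-- the order of 2 mod p. If 2 is a primitive root, the p - 1 residues other than e form a single
-- cycle, which passes through 0. Otherwise the cycle through 0 has fewer than p - 1 points, so
-- some residue other than e lies off it and never reaches 0.
module Submission where

open import Defs
open import Data.Fin as Fin using (Fin; toℕ; fromℕ<; punchOut)
open import Data.Fin.Properties
  using (pigeonhole; punchOut-injective; ¬∀⟶∃¬; <⇒notInjective; toℕ-injective; toℕ<n; fromℕ<-injective)
open import Data.List using (List; _∷_; length; map; upTo; lookup)
open import Data.List.Membership.Propositional using (_∈_; _∉_)
open import Data.List.Membership.Propositional.Properties using (∈-map⁺; ∈-upTo⁺)
open import Data.List.Properties using (length-map; length-upTo)
open import Data.List.Relation.Unary.Any using (here; there; index)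
open import Data.List.Relation.Unary.Any.Properties using (lookup-index)
open import Data.Nat
open import Data.Nat.Properties
open import Data.List.Membership.DecPropositional _≟_ using (_∈?_)
open import Data.Nat.DivMod
open import Data.Nat.Divisibility using (_∣_; divides; n∣m⇒m%n≡0)
open import Data.Nat.Primality using (Prime; prime⇒nonZero; euclidsLemma; ¬prime[0]; ¬prime[1])
open import Data.Nat.Tactic.RingSolver using (solve-∀)
open import Data.Product using (∃-syntax; ∃₂; _×_; _,_; proj₁; proj₂)
open import Data.Sum using (_⊎_; inj₁; inj₂)
open import Function.Base using (_∘_)
open import Function.Bundles using (_⇔_; mk⇔)
open import Function.Definitions using (Injective)
open import Relation.Binary.PropositionalEquality
open import Relation.Nullary using (¬_; contradiction; yes; no; _×-dec_)

open ≡-Reasoning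

pigeonhole-avoiding : ∀ {m n} (f : Fin m → Fin (suc (suc n))) {a b} → n < m → a ≢ b →
  (∀ j → f j ≢ a) → (∀ j → f j ≢ b) → ∃₂ λ i j → i Fin.< j × f i ≡ f j
pigeonhole-avoiding {m} {n} f {a} {b} n<m a≢b f≢a f≢b =
  let i , j , i<j , gi≡gj = pigeonhole n<m g in
  i , j , i<j , punchOut-injective (a≢f i) (a≢f j) (punchOut-injective (b′≢f′ i) (b′≢f′ j) gi≡gj)
  where
  a≢f : ∀ j → a ≢ f j
  a≢f j = f≢a j ∘ sym
  f′ : ∀ j → Fin (suc n)
  f′ j = punchOut (a≢f j)
  b′≢f′ : ∀ j → punchOut a≢b ≢ f′ j
  b′≢f′ j = f≢b j ∘ sym ∘ punchOut-injective a≢b (a≢f j)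
  g : Fin m → Fin n
  g j = punchOut (b′≢f′ j)

length<⇒∃∉ : ∀ {n} (xs : List ℕ) → length xs < n → ∃[ x ] x < n × x ∉ xs
length<⇒∃∉ {n} xs len<n =
  let j , j∉xs = ¬∀⟶∃¬ n (λ j → toℕ j ∈ xs) (λ j → toℕ j ∈? xs) ¬all∈ in
  toℕ j , toℕ<n j , j∉xs
  where
  ¬all∈ : ¬ (∀ j → toℕ j ∈ xs)
  ¬all∈ all∈ = <⇒notInjective len<n index-injective
    where
    index-injective : Injective _≡_ _≡_ (λ j → index (all∈ j))
    index-injective {i} {j} eq = toℕ-injective (begin
      toℕ i                      ≡⟨ lookup-index (all∈ i) ⟩
      lookup xs (index (all∈ i)) ≡⟨ cong (lookup xs) eq ⟩
      lookup xs (index (all∈ j)) ≡⟨ lookup-index (all∈ j) ⟨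
      toℕ j                      ∎)

¬PrimitiveRoot⇒power≡1 : ∀ a p .{{_ : NonZero p}} → a % p ≢ 0 → ¬ PrimitiveRoot a p →
  ∃[ k ] 0 < k × k < p ∸ 1 × a ^ k % p ≡ 1
¬PrimitiveRoot⇒power≡1 a p a≢0 ¬prim with anyUpTo? (λ k → 0 <? k ×-dec a ^ k % p ≟ 1) (p ∸ 1)
... | yes (k , k<p∸1 , 0<k , aᵏ≡1) = k , 0<k , k<p∸1 , aᵏ≡1
... | no ∄k = contradiction (a≢0 , λ k 0<k k<p∸1 aᵏ≡1 → ∄k (k , k<p∸1 , 0<k , aᵏ≡1)) ¬prim

%≡%⇒≡ : ∀ {x y p} .{{_ : NonZero p}} → x < p → y < p → x % p ≡ y % p → x ≡ y
%≡%⇒≡ x<p y<p eq = trans (sym (m<n⇒m%n≡m x<p)) (trans eq (m<n⇒m%n≡m y<p))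

%-absorbˡ-+ : ∀ x y p .{{_ : NonZero p}} → (x % p + y) % p ≡ (x + y) % p
%-absorbˡ-+ x y p = begin
  (x % p + y) % p         ≡⟨ %-distribˡ-+ (x % p) y p ⟩
  (x % p % p + y % p) % p ≡⟨ cong (λ z → (z + y % p) % p) (m%n%n≡m%n x p) ⟩
  (x % p + y % p) % p     ≡⟨ %-distribˡ-+ x y p ⟨
  (x + y) % p             ∎

%-absorbʳ-* : ∀ x y p .{{_ : NonZero p}} → (x * (y % p)) % p ≡ (x * y) % p
%-absorbʳ-* x y p = begin
  (x * (y % p)) % p         ≡⟨ %-distribˡ-* x (y % p) p ⟩
  (x % p * (y % p % p)) % p ≡⟨ cong (λ z → (x % p * z) % p) (m%n%n≡m%n y p) ⟩
  (x % p * (y % p)) % p     ≡⟨ %-distribˡ-* x y p ⟨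
  (x * y) % p               ∎

%-absorbˡ-* : ∀ x y p .{{_ : NonZero p}} → (x % p * y) % p ≡ (x * y) % p
%-absorbˡ-* x y p = begin
  (x % p * y) % p   ≡⟨ cong (_% p) (*-comm (x % p) y) ⟩
  (y * (x % p)) % p ≡⟨ %-absorbʳ-* y x p ⟩
  (y * x) % p       ≡⟨ cong (_% p) (*-comm y x) ⟩
  (x * y) % p       ∎

-- Adding k * pred p undoes the shift by k, since k + k * pred p = k * p.
+-cancelʳ-% : ∀ x y k p .{{_ : NonZero p}} → (x + k) % p ≡ (y + k) % p → x % p ≡ y % p
+-cancelʳ-% x y k p eq = begin
  x % p                          ≡⟨ [m+kn]%n≡m%n x k p ⟨
  (x + k * p) % p                ≡⟨ cong (_% p) (regroup x) ⟩
  (x + k + k * pred p) % p       ≡⟨ %-absorbˡ-+ (x + k) (k * pred p) p ⟨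
  ((x + k) % p + k * pred p) % p ≡⟨ cong (λ z → (z + k * pred p) % p) eq ⟩
  ((y + k) % p + k * pred p) % p ≡⟨ %-absorbˡ-+ (y + k) (k * pred p) p ⟩
  (y + k + k * pred p) % p       ≡⟨ cong (_% p) (regroup y) ⟨
  (y + k * p) % p                ≡⟨ [m+kn]%n≡m%n y k p ⟩
  y % p                          ∎
  where
  regroup : ∀ z → z + k * p ≡ z + k + k * pred p
  regroup z = begin
    z + k * p            ≡⟨ cong (λ n → z + k * n) (suc-pred p) ⟨
    z + k * suc (pred p) ≡⟨ cong (z +_) (*-suc k (pred p)) ⟩
    z + (k + k * pred p) ≡⟨ +-assoc z k (k * pred p) ⟨
    z + k + k * pred p   ∎

%≡%⇒∣∸ : ∀ x y p .{{_ : NonZero p}} → x % p ≡ y % p → p ∣ y ∸ x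
%≡%⇒∣∸ x y p eq = divides (y / p ∸ x / p) (begin
  y ∸ x                                     ≡⟨ cong₂ _∸_ (m≡m%n+[m/n]*n y p) (m≡m%n+[m/n]*n x p) ⟩
  (y % p + y / p * p) ∸ (x % p + x / p * p) ≡⟨ cong (λ z → (z + y / p * p) ∸ (x % p + x / p * p)) eq ⟨
  (x % p + y / p * p) ∸ (x % p + x / p * p) ≡⟨ [m+n]∸[m+o]≡n∸o (x % p) _ _ ⟩
  y / p * p ∸ x / p * p                     ≡⟨ *-distribʳ-∸ p (y / p) (x / p) ⟨
  (y / p ∸ x / p) * p                       ∎)

module _ {p : ℕ} .{{_ : NonZero p}} (p-prime : Prime p) (w : ℕ) (w≢0 : w % p ≢ 0) where

  *-cancelˡ-%-≤ : ∀ {x y} → x ≤ y → (w * x) % p ≡ (w * y) % p → x % p ≡ y % p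
  *-cancelˡ-%-≤ {x} {y} x≤y eq
    with euclidsLemma w (y ∸ x) p-prime (subst (p ∣_) (sym (*-distribˡ-∸ w y x)) (%≡%⇒∣∸ _ _ p eq))
  ... | inj₁ p∣w   = contradiction (n∣m⇒m%n≡0 w p p∣w) w≢0
  ... | inj₂ p∣y∸x = begin
    x % p             ≡⟨ %-remove-+ʳ x p∣y∸x ⟨
    (x + (y ∸ x)) % p ≡⟨ cong (_% p) (m+[n∸m]≡n x≤y) ⟩
    y % p             ∎

  *-cancelˡ-% : ∀ x y → (w * x) % p ≡ (w * y) % p → x % p ≡ y % p
  *-cancelˡ-% x y eq with ≤-total x y
  ... | inj₁ x≤y = *-cancelˡ-%-≤ x≤y eq
  ... | inj₂ y≤x = sym (*-cancelˡ-%-≤ y≤x (sym eq))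

module _ (n : ℕ) where

  negOnePow-bounds : ∀ j → 0 < negOnePow j (2 + n) × negOnePow j (2 + n) < 2 + n
  negOnePow-bounds zero = s≤s z≤n , s≤s (s≤s z≤n)
  negOnePow-bounds (suc j) with 0<x , x<p ← negOnePow-bounds j
    = subst (λ z → 0 < z × z < 2 + n) (sym (m<n⇒m%n≡m p∸x<p)) (m<n⇒0<n∸m x<p , p∸x<p)
    where
    p∸x<p : 2 + n ∸ negOnePow j (2 + n) < 2 + n
    p∸x<p = ∸-monoʳ-< 0<x (<⇒≤ x<p)

  negOnePow-suc+negOnePow : ∀ j → negOnePow (suc j) (2 + n) + negOnePow j (2 + n) ≡ 2 + n
  negOnePow-suc+negOnePow j = begin
    (2 + n ∸ x) % (2 + n) + x ≡⟨ cong (_+ x) (m<n⇒m%n≡m (∸-monoʳ-< 0<x (<⇒≤ x<p))) ⟩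
    2 + n ∸ x + x             ≡⟨ m∸n+n≡m (<⇒≤ x<p) ⟩
    2 + n                     ∎
    where
    x : ℕ
    x = negOnePow j (2 + n)
    0<x : 0 < x
    0<x = proj₁ (negOnePow-bounds j)
    x<p : x < 2 + n
    x<p = proj₂ (negOnePow-bounds j)

module RogueSequence (q : ℕ) (p-prime : Prime (3 + q)) (i : ℕ) where

  p : ℕ
  p = 3 + q

  e c : ℕ
  e = negOnePow i p
  c = negOnePow (suc i) p

  u : ℕ → ℕ → ℕ
  u = roguePt i p

  e<p : e < p
  e<p = proj₂ (negOnePow-bounds (suc q) i)

  e≢0 : e ≢ 0
  e≢0 e≡0 = <-irrefl (sym e≡0) (proj₁ (negOnePow-bounds (suc q) i))

  c+e≡p : c + e ≡ p
  c+e≡p = negOnePow-suc+negOnePow (suc q) i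

  u-< : ∀ {g} n → g < p → u g n < p
  u-< zero    g<p = g<p
  u-< {g} (suc n) _ = m%n<n (2 * u g n + c) p

  u-+ : ∀ g m n → u g (m + n) ≡ u (u g n) m
  u-+ g zero    n = refl
  u-+ g (suc m) n = cong (λ x → (2 * x + c) % p) (u-+ g m n)

  u+c≡2^n*[g+c] : ∀ g n → (u g n + c) % p ≡ (2 ^ n * (g + c)) % p
  u+c≡2^n*[g+c] g zero    = cong (_% p) (sym (*-identityˡ (g + c)))
  u+c≡2^n*[g+c] g (suc n) = begin
    ((2 * x + c) % p + c) % p          ≡⟨ %-absorbˡ-+ (2 * x + c) c p ⟩
    (2 * x + c + c) % p                ≡⟨ cong (_% p) (double-shift x c) ⟩
    (2 * (x + c)) % p                  ≡⟨ %-absorbʳ-* 2 (x + c) p ⟨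
    (2 * ((x + c) % p)) % p            ≡⟨ cong (λ z → (2 * z) % p) (u+c≡2^n*[g+c] g n) ⟩
    (2 * ((2 ^ n * (g + c)) % p)) % p  ≡⟨ %-absorbʳ-* 2 (2 ^ n * (g + c)) p ⟩
    (2 * (2 ^ n * (g + c))) % p        ≡⟨ cong (_% p) (*-assoc 2 (2 ^ n) (g + c)) ⟨
    (2 ^ suc n * (g + c)) % p          ∎
    where
    x : ℕ
    x = u g n
    double-shift : ∀ x c → 2 * x + c + c ≡ 2 * (x + c)
    double-shift = solve-∀

  +c-injective : ∀ {x y} → x < p → y < p → (x + c) % p ≡ (y + c) % p → x ≡ y
  +c-injective {x} {y} x<p y<p eq = %≡%⇒≡ x<p y<p (+-cancelʳ-% x y c p eq)

  +c≡0⇒≡e : ∀ {x} → x < p → (x + c) % p ≡ 0 → x ≡ e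
  +c≡0⇒≡e x<p x+c≡0 = +c-injective x<p e<p (trans x+c≡0 (sym e+c≡0))
    where
    e+c≡0 : (e + c) % p ≡ 0
    e+c≡0 = trans (cong (_% p) (trans (+-comm e c) c+e≡p)) (n%n≡0 p)

  e-fixed : (2 * e + c) % p ≡ e
  e-fixed = begin
    (2 * e + c) % p   ≡⟨ cong (_% p) (regroup e c) ⟩
    (e + (c + e)) % p ≡⟨ cong (λ z → (e + z) % p) c+e≡p ⟩
    (e + p) % p       ≡⟨ [m+n]%n≡m%n e p ⟩
    e % p             ≡⟨ m<n⇒m%n≡m e<p ⟩
    e                 ∎
    where
    regroup : ∀ e c → 2 * e + c ≡ e + (c + e)
    regroup = solve-∀

  step≡e⇒≡e : ∀ {x} → x < p → (2 * x + c) % p ≡ e → x ≡ e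
  step≡e⇒≡e {x} x<p eq = %≡%⇒≡ x<p e<p
    (*-cancelˡ-% p-prime 2 (λ ()) x e (+-cancelʳ-% (2 * x) (2 * e) c p (trans eq (sym e-fixed))))

  u-≢e : ∀ {g} → g < p → g ≢ e → ∀ n → u g n ≢ e
  u-≢e g<p g≢e zero    = g≢e
  u-≢e g<p g≢e (suc n) = u-≢e g<p g≢e n ∘ step≡e⇒≡e (u-< n g<p)

  2^k%p≡1⇒u[x,k]≡x : ∀ k → 2 ^ k % p ≡ 1 → ∀ {x} → x < p → u x k ≡ x
  2^k%p≡1⇒u[x,k]≡x k 2ᵏ≡1 {x} x<p = +c-injective (u-< k x<p) x<p (begin
    (u x k + c) % p           ≡⟨ u+c≡2^n*[g+c] x k ⟩
    (2 ^ k * (x + c)) % p     ≡⟨ %-absorbˡ-* (2 ^ k) (x + c) p ⟨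
    (2 ^ k % p * (x + c)) % p ≡⟨ cong (λ z → (z * (x + c)) % p) 2ᵏ≡1 ⟩
    (1 * (x + c)) % p         ≡⟨ cong (_% p) (*-identityˡ (x + c)) ⟩
    (x + c) % p               ∎)

  u[x,k]≡x⇒2^k%p≡1 : ∀ k {x} → x < p → x ≢ e → u x k ≡ x → 2 ^ k % p ≡ 1
  u[x,k]≡x⇒2^k%p≡1 k {x} x<p x≢e uxk≡x = *-cancelˡ-% p-prime (x + c) (x≢e ∘ +c≡0⇒≡e x<p) (2 ^ k) 1 (begin
    ((x + c) * 2 ^ k) % p ≡⟨ cong (_% p) (*-comm (x + c) (2 ^ k)) ⟩
    (2 ^ k * (x + c)) % p ≡⟨ u+c≡2^n*[g+c] x k ⟨
    (u x k + c) % p       ≡⟨ cong (λ z → (z + c) % p) uxk≡x ⟩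
    (x + c) % p           ≡⟨ cong (_% p) (*-identityʳ (x + c)) ⟨
    ((x + c) * 1) % p     ∎)

  module _ (k : ℕ) (2ᵏ≡1 : 2 ^ k % p ≡ 1) {x : ℕ} (x<p : x < p) where

    u[x,n*k]≡x : ∀ n → u x (n * k) ≡ x
    u[x,n*k]≡x zero    = refl
    u[x,n*k]≡x (suc n) = begin
      u x (k + n * k)     ≡⟨ u-+ x k (n * k) ⟩
      u (u x (n * k)) k   ≡⟨ cong (λ y → u y k) (u[x,n*k]≡x n) ⟩
      u x k               ≡⟨ 2^k%p≡1⇒u[x,k]≡x k 2ᵏ≡1 x<p ⟩
      x                   ∎

    u[x,m]∈orbit : .{{_ : NonZero k}} → ∀ m → u x m ∈ map (u x) (upTo k)
    u[x,m]∈orbit m = subst (_∈ map (u x) (upTo k)) (sym u[m]≡u[m%k]) (∈-map⁺ (u x) (∈-upTo⁺ (m%n<n m k)))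
      where
      u[m]≡u[m%k] : u x m ≡ u x (m % k)
      u[m]≡u[m%k] = begin
        u x m                         ≡⟨ cong (u x) (m≡m%n+[m/n]*n m k) ⟩
        u x (m % k + m / k * k)       ≡⟨ u-+ x (m % k) (m / k * k) ⟩
        u (u x (m / k * k)) (m % k)   ≡⟨ cong (λ y → u y (m % k)) (u[x,n*k]≡x (m / k)) ⟩
        u x (m % k)                   ∎

  -- If g reached 0 it would lie on the cycle through 0.
  ∉orbit₀⇒rogue : ∀ k .{{_ : NonZero k}} → 2 ^ k % p ≡ 1 → ∀ {g} → g < p →
    g ∉ e ∷ map (u 0) (upTo k) → InA i p g × RogueLoop i p g
  ∉orbit₀⇒rogue k 2ᵏ≡1 {g} g<p g∉ = (g<p , g≢0 , g∉ ∘ here) , g-loop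
    where
    g≢0 : g ≢ 0
    g≢0 g≡0 = g∉ (there (subst (_∈ _) (sym g≡0) (u[x,m]∈orbit k 2ᵏ≡1 (s≤s z≤n) 0)))

    g-loop : RogueLoop i p g
    g-loop n ugn≡0 = g∉ (there (subst (_∈ _) (sym g≡u0) (u[x,m]∈orbit k 2ᵏ≡1 (s≤s z≤n) (n * pred k))))
      where
      g≡u0 : g ≡ u 0 (n * pred k)
      g≡u0 = begin
        g                       ≡⟨ u[x,n*k]≡x k 2ᵏ≡1 g<p n ⟨
        u g (n * k)             ≡⟨ cong (λ m → u g (n * m)) (suc-pred k) ⟨
        u g (n * suc (pred k))  ≡⟨ cong (u g) (trans (*-suc n (pred k)) (+-comm n (n * pred k))) ⟩
        u g (n * pred k + n)    ≡⟨ u-+ g (n * pred k) n ⟩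
        u (u g n) (n * pred k)  ≡⟨ cong (λ y → u y (n * pred k)) ugn≡0 ⟩
        u 0 (n * pred k)        ∎

  short-period⇒rogue : ∀ k → 0 < k → k < p ∸ 1 → 2 ^ k % p ≡ 1 → RogueOfKind i p
  short-period⇒rogue k 0<k k<p∸1 2ᵏ≡1 =
    let g , g<p , g∉ = length<⇒∃∉ (e ∷ map (u 0) (upTo k)) length<p
    in g , ∉orbit₀⇒rogue k {{>-nonZero 0<k}} 2ᵏ≡1 g<p g∉
    where
    length<p : length (e ∷ map (u 0) (upTo k)) < p
    length<p = subst (_< p) (cong suc (sym (trans (length-map (u 0) (upTo k)) (length-upTo k)))) (s≤s k<p∸1)

  ¬primitive⇒rogue : ¬ PrimitiveRoot 2 p → RogueOfKind i p
  ¬primitive⇒rogue ¬prim =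
    let k , 0<k , k<p∸1 , 2ᵏ≡1 = ¬PrimitiveRoot⇒power≡1 2 p (λ ()) ¬prim
    in short-period⇒rogue k 0<k k<p∸1 2ᵏ≡1

  -- The first p - 1 terms avoid both 0 and e, so two of them coincide.
  rogue⇒¬primitive : RogueOfKind i p → ¬ PrimitiveRoot 2 p
  rogue⇒¬primitive (g , (g<p , _ , g≢e) , g-loop) (_ , no-power≡1) =
    let a , b , a<b , fa≡fb = pigeonhole-avoiding f ≤-refl 0≢e f≢0 f≢e
        uga≡ugb = fromℕ<-injective _ _ (u-< (toℕ a) g<p) (u-< (toℕ b) g<p) fa≡fb
    in no-power≡1 (toℕ b ∸ toℕ a) (m<n⇒0<n∸m a<b) (≤-<-trans (m∸n≤m (toℕ b) (toℕ a)) (toℕ<n b))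
         (repeat⇒2^k%p≡1 a<b uga≡ugb)
    where
    f : Fin (p ∸ 1) → Fin p
    f j = fromℕ< (u-< (toℕ j) g<p)

    0≢e : fromℕ< {0} {p} (s≤s z≤n) ≢ fromℕ< e<p
    0≢e = e≢0 ∘ sym ∘ fromℕ<-injective 0 e (s≤s z≤n) e<p

    f≢0 : ∀ j → f j ≢ fromℕ< (s≤s z≤n)
    f≢0 j = g-loop (toℕ j) ∘ fromℕ<-injective (u g (toℕ j)) 0 (u-< (toℕ j) g<p) (s≤s z≤n)

    f≢e : ∀ j → f j ≢ fromℕ< e<p
    f≢e j = u-≢e g<p g≢e (toℕ j) ∘ fromℕ<-injective (u g (toℕ j)) e (u-< (toℕ j) g<p) e<p

    repeat⇒2^k%p≡1 : ∀ {a b} → a < b → u g a ≡ u g b → 2 ^ (b ∸ a) % p ≡ 1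
    repeat⇒2^k%p≡1 {a} {b} a<b uga≡ugb = u[x,k]≡x⇒2^k%p≡1 (b ∸ a) (u-< a g<p) (u-≢e g<p g≢e a) (begin
      u (u g a) (b ∸ a) ≡⟨ u-+ g (b ∸ a) a ⟨
      u g (b ∸ a + a)   ≡⟨ cong (u g) (m∸n+n≡m (<⇒≤ a<b)) ⟩
      u g b             ≡⟨ uga≡ugb ⟨
      u g a             ∎)

-- The hypothesis on i is unused: the argument only needs
-- negOnePow (suc i) p + negOnePow i p ≡ p, which holds for every i.
mainTheorem2 : (p : ℕ) (pr : Prime p) → p ≢ 2 → (i : ℕ) → (i ≡ 1 ⊎ i ≡ 2) →
    RogueOfKind i p {{prime⇒nonZero pr}} ⇔ (¬ PrimitiveRoot 2 p {{prime⇒nonZero pr}})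
mainTheorem2 0 pr = contradiction pr ¬prime[0]
mainTheorem2 1 pr = contradiction pr ¬prime[1]
mainTheorem2 2 _ p≢2 = contradiction refl p≢2
mainTheorem2 (suc (suc (suc q))) pr _ i _ = mk⇔ rogue⇒¬primitive ¬primitive⇒rogue
  where open RogueSequence q pr i
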